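{- Let $S\subseteq N$, let $H\in\{H_{\mathrm{odd}},H_{\mathrm{even}}\}$, and let $I_i\in\mathcal{I}_i$ for every $i\in H$. Then $\bigcup_{i\in H} I_i\in\mathcal{I}$.
   Context: $M=(N,\mathcal{I})$ is a matroid with rank function $r$ and span $\mathrm{span}(A)=\{e\in N: r(A\cup\{e\})=r(A)\}$. Weights $w:N\to\mathbb{R}_{>0}$, and values $\tilde\rho\ge 1$, $W>0$ are given. Let $h=\lceil 3+\log_2\tilde{\rho}\rceil$ and for $i\in\{1,\dots,h\}$ let $C_i=\{e\in N: w(e)\in (W/2^{h-i+1}, W/2^{h-i}]\}$. A bucketing $(B_1,\dots,B_b)$ partitions the weight classes into buckets $B_i=\bigcup_{j=f(B_i)}^{\ell(B_i)}C_j$ with $f(B_1)=1$, $\ell(B_i)+1=f(B_{i+1})$ for $1\le i<b$, $\ell(B_b)=h$; by convention $B_j=\varnothing$ for $j>b$ and $f(B_j)=\ell(B_j)=0$ for $j\le0$; $B_{\ge i}=\bigcup_{j\ge i}B_j$. Given $S$, define $M_1=(M/(S\cap B_{\geq 2}))|_{B_1}$ and $M_i=(M/(S\cap B_{\geq i+1}))|_{B_i\cap \mathrm{span}(S\cap B_{\geq i-1})}$ for $i\in\{2,\dots,h\}$ ($/$ = contraction, $|$ = restriction), with independent-set family $\mathcal{I}_i$. $H_{\mathrm{odd}}=\{i\in\{1,\dots,h\}: i\text{ odd}\}$, $H_{\mathrm{even}}=\{i\in\{1,\dots,h\}: i\text{ even}\}$.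
   Formalization: The weights $w$ and the values $\tilde\rho$ and $W$ are rational rather than real. -}

module Defs where

open import Data.Nat as ℕ using (ℕ; zero; suc; _+_; _∸_; _≡ᵇ_)
import Data.Nat.Properties as ℕP
open import Data.Fin using (Fin)
open import Data.Fin.Subset using (Subset; _∪_; _∩_; _⊆_; ∣_∣; ⁅_⁆; ⊥; ∁; _∈_; _∉_; ⋃)
open import Data.Vec using (tabulate)
open import Data.List using (List; map; upTo)
open import Data.Bool using (Bool; true; false; _∧_)
open import Data.Product using (Σ; ∃; _×_; _,_)
open import Data.Integer using (+_)
open import Data.Rational as ℚ using (ℚ; ½; 1ℚ; _/_)
import Data.Rational.Properties as ℚP
open import Relation.Nullary.Decidable using (does)
open import Relation.Binary.PropositionalEquality using (_≡_)
import Relation.Nullary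

record Matroid (n : ℕ) : Set₁ where
  field
    Indep      : Subset n → Set
    indep-∅    : Indep ⊥
    indep-↓    : ∀ {I J} → I ⊆ J → Indep J → Indep I
    indep-aug  : ∀ {I J} → Indep I → Indep J → ∣ I ∣ ℕ.< ∣ J ∣ →
                 ∃ λ e → e ∈ J × (Indep (I ∪ ⁅ e ⁆) × e ∉ I)
    r          : Subset n → ℕ
    r-attained : ∀ A → Σ (Subset n) λ I → I ⊆ A × Indep I × ∣ I ∣ ≡ r A
    r-max      : ∀ A I → I ⊆ A → Indep I → ∣ I ∣ ℕ.≤ r A
  span : Subset n → Subset n
  span A = tabulate (λ e → does (r (A ∪ ⁅ e ⁆) ℕP.≟ r A))

open Matroid public

-- Independent sets of the minor (M / T) | Y   (contraction by T, then
-- restriction to Y ⊆ N ∖ T), via the contraction rank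
-- r_{M/T}(X) = r(X ∪ T) - r(T):  X ⊆ Y, X ∩ T = ∅, r_{M/T}(X) = |X|.
IndepMinor : ∀ {n} → Matroid n → (T Y : Subset n) → Subset n → Set
IndepMinor M T Y X = X ⊆ Y × (X ∩ T ≡ ⊥) × (r M (X ∪ T) ∸ r M T ≡ ∣ X ∣)

-- the list [a, a+1, ..., c]  (empty if c < a)
range : ℕ → ℕ → List ℕ
range a c = map (λ k → a + k) (upTo (suc c ∸ a))

⋃[_,_] : ∀ {n} → ℕ → ℕ → (ℕ → Subset n) → Subset n
⋃[ a , c ] F = ⋃ (map F (range a c))

halfPow : ℕ → ℚ
halfPow zero    = 1ℚ
halfPow (suc k) = ½ ℚ.* halfPow k

twoPow : ℕ → ℚ
twoPow k = + (2 ℕ.^ k) / 1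

-- h = ⌈3 + log₂ ρ̃⌉, i.e. h is the least natural number with 3 + log₂ ρ̃ ≤ h,
-- equivalently 8ρ̃ ≤ 2^h.
IsH : ℚ → ℕ → Set
IsH ρ h = ((+ 8 / 1) ℚ.* ρ ℚ.≤ twoPow h)
        × (∀ k → (+ 8 / 1) ℚ.* ρ ℚ.≤ twoPow k → h ℕ.≤ k)

C : ∀ {n} → (w : Fin n → ℚ) → (W : ℚ) → (h i : ℕ) → Subset n
C w W h i = tabulate (λ e →
  does (W ℚ.* halfPow (suc h ∸ i) ℚP.<? w e) ∧ does (w e ℚP.≤? W ℚ.* halfPow (h ∸ i)))

-- Bucketings: b buckets, bucket j (1 ≤ j ≤ b) consists of the classes
-- C_{f j}, ..., C_{ℓ j}.

record Bucketing (h : ℕ) : Set where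
  field
    b      : ℕ
    f      : ℕ → ℕ
    ℓ      : ℕ → ℕ
    b≥1    : 1 ℕ.≤ b
    f-1    : f 1 ≡ 1
    f≤ℓ    : ∀ i → 1 ℕ.≤ i → i ℕ.≤ b → f i ℕ.≤ ℓ i
    consec : ∀ i → 1 ℕ.≤ i → i ℕ.< b → ℓ i + 1 ≡ f (suc i)
    ℓ-b    : ℓ b ≡ h

open Bucketing public

module _ {n : ℕ} (w : Fin n → ℚ) (W : ℚ) (h : ℕ) (β : Bucketing h) where

  Bk : ℕ → Subset n
  Bk zero    = ⊥
  Bk (suc j) with suc j ℕ.≤? b β
  ... | Relation.Nullary.yes _ = ⋃[ f β (suc j) , ℓ β (suc j) ] (C w W h)
  ... | Relation.Nullary.no  _ = ⊥

  B≥ : ℕ → Subset n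
  B≥ j = ⋃[ j , b β ] Bk


  Contr : Subset n → ℕ → Subset n
  Contr S i = S ∩ B≥ (suc i)

  Restr : Matroid n → Subset n → ℕ → Subset n
  Restr M S zero          = Bk zero
  Restr M S (suc zero)    = Bk 1
  Restr M S (suc (suc j)) = Bk (suc (suc j)) ∩ span M (S ∩ B≥ (suc j))

  Indepᵢ : Matroid n → Subset n → ℕ → Subset n → Set
  Indepᵢ M S i X = IndepMinor M (Contr S i) (Restr M S i) X

data Parity : Set where
  odd even : Parity

parity : ℕ → Parity
parity zero    = even
parity (suc k) with parity k
... | odd  = even
... | even = odd

InH : Parity → ℕ → ℕ → Set
InH p h i = 1 ℕ.≤ i × i ℕ.≤ h × parity i ≡ p

⋃H : ∀ {n} → Parity → ℕ → (ℕ → Subset n) → Subset n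
⋃H p h I = ⋃[ 1 , h ] (λ i → sel (parity i) p (I i))
  where
  sel : ∀ {n} → Parity → Parity → Subset n → Subset n
  sel odd  odd  X = X
  sel even even X = X
  sel _    _    _ = ⊥

{-# OPTIONS --safe #-}
module Submission where

-- Induct downwards on k with the invariant: for U k = ⋃ {I i : i ∈ H, i ≥ k} there is
-- K ⊆ S ∩ B_{≥k} with U k ∪ K independent. For k ∈ H, the index k + 1 is not in H and every
-- I i with i ≥ k + 2 lies in span(S ∩ B_{≥k+1}) by the definition of M_i. Hence U (k + 1)
-- adds nothing to the rank of T = S ∩ B_{≥k+1}, and I k, independent in M / T, can be added
-- to U (k + 1) at the price of replacing K by another subset of T.

open import Defs
open import Data.Nat using (ℕ)
open import Data.Fin using (Fin)
open import Data.Fin.Subset using (Subset)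
open import Data.Rational using (ℚ; 0ℚ; 1ℚ; _<_; _≤_)

open import Data.Nat using (zero; suc; _+_; _∸_; z≤n; s≤s; _≤?_)
  renaming (_≤_ to _≤ₙ_; _<_ to _<ₙ_)
open import Data.Nat.Properties
  using (≤-refl; ≤-trans; ≤-reflexive; ≤-antisym; <⇒≱; ≰⇒>; +-suc; +-comm; +-monoʳ-≤;
         m≤m+n; n≤1+n; +-identityʳ; m+n∸m≡n; m+[n∸m]≡n; m∸n+n≡m; ∸-monoˡ-≤; ∸-monoˡ-<; m≤n⇒m<n∨m≡n; module ≤-Reasoning)
  renaming (_≟_ to _≟ₙ_)
open import Data.Fin.Subset using (_∪_; _∩_; _⊆_; ∣_∣; ⁅_⁆; ⊥; _∈_; _∉_; ⋃)
open import Data.Fin.Subset.Properties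
  using (_∈?_; ∉⊥; ⊆-refl; ⊆-trans; ⊆-min; x∈⁅x⁆; x∈⁅y⁆⇒x≡y; p⊆q⇒∣p∣≤∣q∣; p⊂q⇒∣p∣<∣q∣;
         ∣p∣≤∣x∷p∣; p∩q⊆p; p∩q⊆q; x∈p∩q⁺; p⊆p∪q; q⊆p∪q; x∈p∪q⁻; x∈p∪q⁺)
open import Data.Vec using (_∷_; [])
open import Data.Vec.Properties using (lookup∘tabulate; []=⇒lookup; lookup⇒[]=)
open import Data.List using (List; allFin) renaming (_∷_ to _∷ₗ_; [] to []ₗ; map to mapₗ)
open import Data.List.Relation.Unary.Any using (here; there)
open import Data.List.Membership.Propositional using () renaming (_∈_ to _∈ₗ_)
open import Data.List.Membership.Propositional.Properties using (∈-map⁺; ∈-map⁻; ∈-upTo⁺; ∈-upTo⁻; ∈-allFin)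
open import Data.Bool using (true; false)
open import Data.Product using (_×_; _,_; ∃-syntax; proj₁; proj₂)
open import Data.Sum as Sum using (_⊎_; inj₁; inj₂; [_,_])
open import Function using (id; _∘_; _⇔_; mk⇔; Equivalence)
open import Relation.Nullary using (¬_; Dec; yes; no; proof; contradiction)
open import Relation.Nullary.Reflects using (Reflects; invert)
open import Relation.Nullary.Decidable using (map′; dec-true; _×-dec_)
open import Relation.Binary.PropositionalEquality using (_≡_; _≢_; refl; sym; trans; cong; subst)

module _ {m : ℕ} where

  private variable
    p q p′ q′ : Subset m
    x : Fin m

  ∪-mono : p ⊆ p′ → q ⊆ q′ → p ∪ q ⊆ p′ ∪ q′
  ∪-mono p⊆ q⊆ = x∈p∪q⁺ ∘ Sum.map p⊆ q⊆ ∘ x∈p∪q⁻ _ _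

  ∪-least : p ⊆ q′ → q ⊆ q′ → p ∪ q ⊆ q′
  ∪-least p⊆ q⊆ = [ p⊆ , q⊆ ] ∘ x∈p∪q⁻ _ _

  x∈p⇒⁅x⁆⊆p : x ∈ p → ⁅ x ⁆ ⊆ p
  x∈p⇒⁅x⁆⊆p {p = p} x∈p y∈⁅x⁆ = subst (_∈ p) (sym (x∈⁅y⁆⇒x≡y _ y∈⁅x⁆)) x∈p

  x∉p⇒∣p∣<∣p∪⁅x⁆∣ : x ∉ p → ∣ p ∣ <ₙ ∣ p ∪ ⁅ x ⁆ ∣
  x∉p⇒∣p∣<∣p∪⁅x⁆∣ {x = x} x∉p = p⊂q⇒∣p∣<∣q∣ (p⊆p∪q _ , x , q⊆p∪q _ _ (x∈⁅x⁆ x) , x∉p)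

  p⊆q∧∣q∣≤∣p∣⇒q⊆p : p ⊆ q → ∣ q ∣ ≤ₙ ∣ p ∣ → q ⊆ p
  p⊆q∧∣q∣≤∣p∣⇒q⊆p {p} p⊆q ∣q∣≤∣p∣ {x} x∈q with x ∈? p
  ... | yes x∈p = x∈p
  ... | no  x∉p = contradiction ∣q∣≤∣p∣ (<⇒≱ (p⊂q⇒∣p∣<∣q∣ (p⊆q , x , x∈q , x∉p)))

∣p∪q∣≤∣p∣+∣q∣ : ∀ {m} (p q : Subset m) → ∣ p ∪ q ∣ ≤ₙ ∣ p ∣ + ∣ q ∣
∣p∪q∣≤∣p∣+∣q∣ []          []          = z≤n
∣p∪q∣≤∣p∣+∣q∣ (true  ∷ p) (s ∷ q)     = s≤s (≤-trans (∣p∪q∣≤∣p∣+∣q∣ p q) (+-monoʳ-≤ ∣ p ∣ (∣p∣≤∣x∷p∣ s q)))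
∣p∪q∣≤∣p∣+∣q∣ (false ∷ p) (true  ∷ q) = ≤-trans (s≤s (∣p∪q∣≤∣p∣+∣q∣ p q)) (≤-reflexive (sym (+-suc ∣ p ∣ ∣ q ∣)))
∣p∪q∣≤∣p∣+∣q∣ (false ∷ p) (false ∷ q) = ∣p∪q∣≤∣p∣+∣q∣ p q

module MatroidProperties {n : ℕ} (M : Matroid n) where

  private variable
    A A′ B B′ I J K T X Y : Subset n
    e : Fin n

  Spans : Subset n → Fin n → Set
  Spans B e = e ∈ B ⊎ ¬ Indep M (B ∪ ⁅ e ⁆)

  Spans-mono : B ⊆ B′ → Spans B e → Spans B′ e
  Spans-mono B⊆B′ (inj₁ e∈B) = inj₁ (B⊆B′ e∈B)
  Spans-mono B⊆B′ (inj₂ dep) = inj₂ (dep ∘ indep-↓ M (∪-mono B⊆B′ ⊆-refl))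

  record IsBasis (A B : Subset n) : Set where
    field
      basis⊆    : B ⊆ A
      indep     : Indep M B
      spanning  : ∀ {e} → e ∈ A → Spans B e

  open IsBasis

  r-mono : A ⊆ A′ → r M A ≤ₙ r M A′
  r-mono {A} A⊆A′ with r-attained M A
  ... | I , I⊆A , indI , ∣I∣≡rA = subst (_≤ₙ _) ∣I∣≡rA (r-max M _ I (A⊆A′ ∘ I⊆A) indI)

  indep⇒r≡∣X∣ : Indep M X → r M X ≡ ∣ X ∣
  indep⇒r≡∣X∣ {X} indX with r-attained M X
  ... | I , I⊆X , _ , ∣I∣≡rX =
    ≤-antisym (subst (_≤ₙ _) ∣I∣≡rX (p⊆q⇒∣p∣≤∣q∣ I⊆X)) (r-max M X X ⊆-refl indX)

  r≡∣X∣⇒indep : r M X ≡ ∣ X ∣ → Indep M X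
  r≡∣X∣⇒indep {X} rX≡∣X∣ with r-attained M X
  ... | I , I⊆X , indI , ∣I∣≡rX =
    indep-↓ M (p⊆q∧∣q∣≤∣p∣⇒q⊆p I⊆X (≤-reflexive (trans (sym rX≡∣X∣) (sym ∣I∣≡rX)))) indI

  indep? : ∀ X → Dec (Indep M X)
  indep? X = map′ r≡∣X∣⇒indep indep⇒r≡∣X∣ (r M X ≟ₙ ∣ X ∣)

  -- A larger independent subset of A would augment B by an element it does not span.
  ∣indep∣≤∣basis∣ : IsBasis A B → Y ⊆ A → Indep M Y → ∣ Y ∣ ≤ₙ ∣ B ∣
  ∣indep∣≤∣basis∣ {B = B} {Y} basis Y⊆A indY with ∣ Y ∣ ≤? ∣ B ∣
  ... | yes ∣Y∣≤∣B∣ = ∣Y∣≤∣B∣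
  ... | no  ∣Y∣≰∣B∣ with indep-aug M (indep basis) indY (≰⇒> ∣Y∣≰∣B∣)
  ...   | e , e∈Y , indBe , e∉B with spanning basis (Y⊆A e∈Y)
  ...     | inj₁ e∈B = contradiction e∈B e∉B
  ...     | inj₂ dep = contradiction indBe dep

  r≡∣basis∣ : IsBasis A B → r M A ≡ ∣ B ∣
  r≡∣basis∣ {A} basis with r-attained M A
  ... | I , I⊆A , indI , ∣I∣≡rA =
    ≤-antisym (subst (_≤ₙ _) ∣I∣≡rA (∣indep∣≤∣basis∣ basis I⊆A indI))
              (r-max M A _ (basis⊆ basis) (indep basis))

  add-if-independent : ∀ x → Indep M B → B ⊆ A →
    ∃[ B′ ] B ⊆ B′ × B′ ⊆ A × Indep M B′ × (x ∈ A → Spans B′ x)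
  add-if-independent {B} {A} x indB B⊆A with x ∈? A | indep? (B ∪ ⁅ x ⁆)
  ... | yes x∈A | yes indBx =
    B ∪ ⁅ x ⁆ , p⊆p∪q _ , ∪-least B⊆A (x∈p⇒⁅x⁆⊆p x∈A) , indBx , λ _ → inj₁ (q⊆p∪q B _ (x∈⁅x⁆ x))
  ... | yes _   | no dep = B , ⊆-refl , B⊆A , indB , λ _ → inj₂ dep
  ... | no x∉A  | _      = B , ⊆-refl , B⊆A , indB , λ x∈A → contradiction x∈A x∉A

  extend-greedily : (xs : List (Fin n)) → Indep M B → B ⊆ A →
    ∃[ B′ ] B ⊆ B′ × B′ ⊆ A × Indep M B′ × (∀ {x} → x ∈ₗ xs → x ∈ A → Spans B′ x)
  extend-greedily []ₗ indB B⊆A = _ , ⊆-refl , B⊆A , indB , λ ()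
  extend-greedily (x ∷ₗ xs) indB B⊆A with add-if-independent x indB B⊆A
  ... | B₁ , B⊆B₁ , B₁⊆A , indB₁ , spans-x with extend-greedily xs indB₁ B₁⊆A
  ...   | B′ , B₁⊆B′ , B′⊆A , indB′ , spans-xs = B′ , ⊆-trans B⊆B₁ B₁⊆B′ , B′⊆A , indB′ , λ where
            (here refl) x∈A → Spans-mono B₁⊆B′ (spans-x x∈A)
            (there y∈xs)    → spans-xs y∈xs

  extend-to-basis : Indep M I → I ⊆ A → ∃[ B ] I ⊆ B × IsBasis A B
  extend-to-basis indI I⊆A with extend-greedily (allFin n) indI I⊆A
  ... | B , I⊆B , B⊆A , indB , spans = B , I⊆B , record
    { basis⊆ = B⊆A ; indep = indB ; spanning = spans (∈-allFin _) }

  basis-exists : ∀ A → ∃[ B ] IsBasis A B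
  basis-exists A with extend-to-basis (indep-∅ M) (⊆-min A)
  ... | B , _ , basis = B , basis

  basis-∪ : IsBasis A B → (∀ {e} → e ∈ X → Spans B e) → IsBasis (A ∪ X) B
  basis-∪ basis spansX = record
    { basis⊆   = p⊆p∪q _ ∘ basis⊆ basis
    ; indep    = indep basis
    ; spanning = [ spanning basis , spansX ] ∘ x∈p∪q⁻ _ _
    }

  basis-of-extension : ∀ {L Q} → IsBasis A L → L ⊆ Q → IsBasis (L ∪ X) Q → IsBasis (A ∪ X) Q
  basis-of-extension basisL L⊆Q basisQ = record
    { basis⊆   = ∪-mono (basis⊆ basisL) ⊆-refl ∘ basis⊆ basisQ
    ; indep    = indep basisQ
    ; spanning = [ Spans-mono L⊆Q ∘ spanning basisL , spanning basisQ ∘ q⊆p∪q _ _ ] ∘ x∈p∪q⁻ _ _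
    }

  indep-∪-of-rank : ∀ {L} → IsBasis A L → ∣ L ∣ + ∣ X ∣ ≤ₙ r M (A ∪ X) → Indep M (L ∪ X)
  indep-∪-of-rank {A} {X} {L} basisL bound with extend-to-basis (indep basisL) (p⊆p∪q X)
  ... | Q , L⊆Q , basisQ = indep-↓ M (p⊆q∧∣q∣≤∣p∣⇒q⊆p (basis⊆ basisQ) ∣L∪X∣≤∣Q∣) (indep basisQ)
    where
    ∣L∪X∣≤∣Q∣ : ∣ L ∪ X ∣ ≤ₙ ∣ Q ∣
    ∣L∪X∣≤∣Q∣ = ≤-trans (∣p∪q∣≤∣p∣+∣q∣ L X)
                  (≤-trans bound (≤-reflexive (r≡∣basis∣ (basis-of-extension basisL L⊆Q basisQ))))

  ∈span⇔ : e ∈ span M A ⇔ r M (A ∪ ⁅ e ⁆) ≡ r M A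
  ∈span⇔ {e} {A} = mk⇔
    (λ e∈ → invert (subst (Reflects _) (trans (sym (lookup∘tabulate _ e)) ([]=⇒lookup e∈))
                                      (proof (r M (A ∪ ⁅ e ⁆) ≟ₙ r M A))))
    (λ eq → lookup⇒[]= e _ (trans (lookup∘tabulate _ e) (dec-true (r M (A ∪ ⁅ e ⁆) ≟ₙ r M A) eq)))

  basis-spans-span : IsBasis A B → e ∈ span M A → Spans B e
  basis-spans-span {A} {B} {e} basis e∈span with e ∈? B
  ... | yes e∈B = inj₁ e∈B
  ... | no  e∉B = inj₂ λ indBe → <⇒≱ (x∉p⇒∣p∣<∣p∪⁅x⁆∣ e∉B) (begin
    ∣ B ∪ ⁅ e ⁆ ∣       ≤⟨ r-max M _ _ (∪-mono (basis⊆ basis) ⊆-refl) indBe ⟩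
    r M (A ∪ ⁅ e ⁆)     ≡⟨ Equivalence.to ∈span⇔ e∈span ⟩
    r M A               ≡⟨ r≡∣basis∣ basis ⟩
    ∣ B ∣               ∎)
    where open ≤-Reasoning

  r-∪-span : X ⊆ span M A → r M (A ∪ X) ≡ r M A
  r-∪-span {X} {A} X⊆span with basis-exists A
  ... | B , basis =
    trans (r≡∣basis∣ (basis-∪ basis (basis-spans-span basis ∘ X⊆span))) (sym (r≡∣basis∣ basis))

  span-mono : A ⊆ A′ → span M A ⊆ span M A′
  span-mono {A} {A′} A⊆A′ {e} e∈span with basis-exists A
  ... | B , basisA with extend-to-basis (indep basisA) (A⊆A′ ∘ basis⊆ basisA)
  ...   | B′ , B⊆B′ , basisA′ = Equivalence.from ∈span⇔
          (trans (r≡∣basis∣ (basis-∪ basisA′ spans-e)) (sym (r≡∣basis∣ basisA′)))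
    where
    spans-e : ∀ {x} → x ∈ ⁅ e ⁆ → Spans B′ x
    spans-e x∈⁅e⁆ rewrite x∈⁅y⁆⇒x≡y e x∈⁅e⁆ = Spans-mono B⊆B′ (basis-spans-span basisA e∈span)

  -- Extend J ∪ K to a basis L of T ∪ J; since J is spanned by T, ∣L∣ = r T, so a set I
  -- independent in M / T has room next to L: L ∪ I is independent.
  contraction-augment : K ⊆ T → Indep M (J ∪ K) → J ⊆ span M T → r M (I ∪ T) ∸ r M T ≡ ∣ I ∣ →
    ∃[ K′ ] K′ ⊆ T × Indep M ((I ∪ J) ∪ K′)
  contraction-augment {K} {T} {J} {I} K⊆T indJK J⊆span rI/T with
    extend-to-basis indJK (∪-least (q⊆p∪q T J) (p⊆p∪q J ∘ K⊆T))
  ... | L , JK⊆L , basisL = L ∩ T , p∩q⊆q L T , indep-↓ M IJK′⊆LI (indep-∪-of-rank basisL bound)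
    where
    open ≤-Reasoning
    bound : ∣ L ∣ + ∣ I ∣ ≤ₙ r M ((T ∪ J) ∪ I)
    bound = begin
      ∣ L ∣ + ∣ I ∣          ≡⟨ cong (_+ ∣ I ∣) (sym (r≡∣basis∣ basisL)) ⟩
      r M (T ∪ J) + ∣ I ∣    ≡⟨ cong (_+ ∣ I ∣) (r-∪-span J⊆span) ⟩
      r M T + ∣ I ∣          ≡⟨ +-comm (r M T) ∣ I ∣ ⟩
      ∣ I ∣ + r M T          ≡⟨ cong (_+ r M T) (sym rI/T) ⟩
      r M (I ∪ T) ∸ r M T + r M T ≡⟨ m∸n+n≡m (r-mono (q⊆p∪q I T)) ⟩
      r M (I ∪ T)            ≤⟨ r-mono (∪-least (q⊆p∪q _ I) (p⊆p∪q I ∘ p⊆p∪q J)) ⟩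
      r M ((T ∪ J) ∪ I)      ∎
    IJK′⊆LI : (I ∪ J) ∪ (L ∩ T) ⊆ L ∪ I
    IJK′⊆LI = ∪-least (∪-least (q⊆p∪q L I) (p⊆p∪q I ∘ JK⊆L ∘ p⊆p∪q K)) (p⊆p∪q I ∘ p∩q⊆p L T)

module _ {m : ℕ} where

  private variable
    x : Fin m
    X : Subset m
    Xs : List (Subset m)
    F : ℕ → Subset m
    a a′ c k : ℕ

  ∈⋃⁻ : ∀ Xs → x ∈ ⋃ Xs → ∃[ X ] X ∈ₗ Xs × x ∈ X
  ∈⋃⁻ []ₗ        x∈ = contradiction x∈ ∉⊥
  ∈⋃⁻ (X ∷ₗ Xs) x∈ with x∈p∪q⁻ X (⋃ Xs) x∈
  ... | inj₁ x∈X = X , here refl , x∈X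
  ... | inj₂ x∈⋃ with ∈⋃⁻ Xs x∈⋃
  ...   | Y , Y∈Xs , x∈Y = Y , there Y∈Xs , x∈Y

  ∈⋃⁺ : X ∈ₗ Xs → x ∈ X → x ∈ ⋃ Xs
  ∈⋃⁺ (here refl) x∈X = p⊆p∪q _ x∈X
  ∈⋃⁺ {Xs = Y ∷ₗ _} (there X∈Xs) x∈X = q⊆p∪q Y _ (∈⋃⁺ X∈Xs x∈X)

  ∈range⁻ : k ∈ₗ range a c → a ≤ₙ k × k ≤ₙ c
  ∈range⁻ {a = a} {c} k∈ with ∈-map⁻ (a +_) k∈
  ... | j , j∈upTo , refl with a + j ≤? c
  ...   | yes a+j≤c = m≤m+n a j , a+j≤c
  ...   | no  a+j≰c = contradiction (begin
          suc c ∸ a   ≤⟨ ∸-monoˡ-≤ a (≰⇒> a+j≰c) ⟩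
          a + j ∸ a   ≡⟨ m+n∸m≡n a j ⟩
          j           ∎) (<⇒≱ (∈-upTo⁻ j∈upTo))
    where open ≤-Reasoning

  ∈range⁺ : a ≤ₙ k → k ≤ₙ c → k ∈ₗ range a c
  ∈range⁺ {a} {k} {c} a≤k k≤c = subst (_∈ₗ range a c) (m+[n∸m]≡n a≤k)
    (∈-map⁺ (a +_) (∈-upTo⁺ (∸-monoˡ-< (s≤s k≤c) a≤k)))

  ∈⋃[]⁻ : ∀ a c → x ∈ ⋃[ a , c ] F → ∃[ k ] a ≤ₙ k × k ≤ₙ c × x ∈ F k
  ∈⋃[]⁻ {F = F} a c x∈ with ∈⋃⁻ (mapₗ F (range a c)) x∈
  ... | X , X∈ , x∈X with ∈-map⁻ F X∈
  ...   | k , k∈range , refl with ∈range⁻ k∈range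
  ...     | a≤k , k≤c = k , a≤k , k≤c , x∈X

  ∈⋃[]⁺ : ∀ {a k c} → a ≤ₙ k → k ≤ₙ c → x ∈ F k → x ∈ ⋃[ a , c ] F
  ∈⋃[]⁺ {F = F} a≤k k≤c = ∈⋃⁺ (∈-map⁺ F (∈range⁺ a≤k k≤c))

  ⋃[]-antitone : ∀ c → a ≤ₙ a′ → ⋃[ a′ , c ] F ⊆ ⋃[ a , c ] F
  ⋃[]-antitone {a′ = a′} c a≤a′ x∈ with ∈⋃[]⁻ a′ c x∈
  ... | k , a′≤k , k≤c , x∈Fk = ∈⋃[]⁺ (≤-trans a≤a′ a′≤k) k≤c x∈Fk

_≟ₚ_ : (p q : Parity) → Dec (p ≡ q)
odd  ≟ₚ odd  = yes refl
odd  ≟ₚ even = no λ ()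
even ≟ₚ odd  = no λ ()
even ≟ₚ even = yes refl

parity-suc≢ : ∀ k → parity (suc k) ≢ parity k
parity-suc≢ k with parity k
... | odd  = λ ()
... | even = λ ()

-- The same selection as the local one inside ⋃H, which ∈⋃H⁻ therefore unfolds by cases.
selectParity : ∀ {m} → Parity → Parity → Subset m → Subset m
selectParity odd  odd  X = X
selectParity even even X = X
selectParity _    _    _ = ⊥

∈selectParity⁻ : ∀ {m} q p {X : Subset m} {x} → x ∈ selectParity q p X → q ≡ p × x ∈ X
∈selectParity⁻ odd  odd  x∈ = refl , x∈
∈selectParity⁻ even even x∈ = refl , x∈
∈selectParity⁻ odd  even x∈ = contradiction x∈ ∉⊥
∈selectParity⁻ even odd  x∈ = contradiction x∈ ∉⊥

∈selectParity⁺ : ∀ {m} p {X : Subset m} {x} → x ∈ X → x ∈ selectParity p p X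
∈selectParity⁺ odd  x∈ = x∈
∈selectParity⁺ even x∈ = x∈

∈⋃H⁻ : ∀ {m} p h (I : ℕ → Subset m) {x} → x ∈ ⋃H p h I → ∃[ i ] InH p h i × x ∈ I i
∈⋃H⁻ p h I x∈ with ∈⋃[]⁻ 1 h x∈
... | i , 1≤i , i≤h , x∈sel with parity i in eq | p
...   | odd  | odd  = i , (1≤i , i≤h , eq) , x∈sel
...   | even | even = i , (1≤i , i≤h , eq) , x∈sel
...   | odd  | even = contradiction x∈sel ∉⊥
...   | even | odd  = contradiction x∈sel ∉⊥

module Minors {n} (M : Matroid n) (w : Fin n → ℚ) (W : ℚ) (h : ℕ) (β : Bucketing h) (S : Subset n) where

  open MatroidProperties M

  S∩B≥-antitone : ∀ {a a′} → a ≤ₙ a′ → S ∩ B≥ w W h β a′ ⊆ S ∩ B≥ w W h β a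
  S∩B≥-antitone a≤a′ x∈ = x∈p∩q⁺ (p∩q⊆p S _ x∈ , ⋃[]-antitone (b β) a≤a′ (p∩q⊆q S _ x∈))

  Restr-⊆-span : ∀ k i → suc (suc k) ≤ₙ i → Restr w W h β M S i ⊆ span M (Contr w W h β S k)
  Restr-⊆-span k (suc (suc j)) (s≤s (s≤s k≤j)) = span-mono (S∩B≥-antitone (s≤s k≤j)) ∘ p∩q⊆q _ _

  module Induction (p : Parity) (I : ℕ → Subset n)
                   (indepᵢ : ∀ i → InH p h i → Indepᵢ w W h β M S i (I i)) where

    private variable
      x : Fin n
      i k : ℕ

    U : ℕ → Subset n
    U k = ⋃[ k , h ] (λ i → selectParity (parity i) p (I i))

    ∈U⁻ : ∀ k → x ∈ U k → ∃[ i ] k ≤ₙ i × i ≤ₙ h × parity i ≡ p × x ∈ I i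
    ∈U⁻ k x∈ with ∈⋃[]⁻ k h x∈
    ... | i , k≤i , i≤h , x∈sel with ∈selectParity⁻ (parity i) p x∈sel
    ...   | pi , x∈Ii = i , k≤i , i≤h , pi , x∈Ii

    ∈U⁺ : k ≤ₙ i → i ≤ₙ h → parity i ≡ p → x ∈ I i → x ∈ U k
    ∈U⁺ k≤i i≤h refl x∈Ii = ∈⋃[]⁺ k≤i i≤h (∈selectParity⁺ p x∈Ii)

    ∈U-split : ∀ k → x ∈ U k → x ∈ U (suc k) ⊎ (k ≤ₙ h × parity k ≡ p × x ∈ I k)
    ∈U-split k x∈ with ∈U⁻ k x∈
    ... | i , k≤i , i≤h , pi , x∈Ii with m≤n⇒m<n∨m≡n k≤i
    ...   | inj₁ k<i  = inj₁ (∈U⁺ k<i i≤h pi x∈Ii)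
    ...   | inj₂ refl = inj₂ (i≤h , pi , x∈Ii)

    -- Only indices of H beyond k + 1 contribute to U (k + 1), as H has no two consecutive elements.
    U-suc⊆span : ∀ k → parity k ≡ p → U (suc k) ⊆ span M (Contr w W h β S k)
    U-suc⊆span k pk x∈ with ∈U⁻ (suc k) x∈
    ... | i , k<i , i≤h , pi , x∈Ii with m≤n⇒m<n∨m≡n k<i
    ...   | inj₁ k+1<i = Restr-⊆-span k i k+1<i (proj₁ (indepᵢ i (≤-trans (s≤s z≤n) k<i , i≤h , pi)) x∈Ii)
    ...   | inj₂ refl  = contradiction (trans pi (sym pk)) (parity-suc≢ k)

    Invariant : ℕ → Set
    Invariant k = ∃[ K ] K ⊆ S ∩ B≥ w W h β k × Indep M (U k ∪ K)

    invariant-above : h <ₙ k → Invariant k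
    invariant-above {k} h<k = ⊥ , ⊆-min _ , indep-↓ M (∪-least U⊆⊥ ⊆-refl) (indep-∅ M)
      where
      U⊆⊥ : U k ⊆ ⊥
      U⊆⊥ x∈ with ∈U⁻ k x∈
      ... | i , k≤i , i≤h , _ = contradiction i≤h (<⇒≱ (≤-trans h<k k≤i))

    invariant-add : InH p h k → Invariant (suc k) → Invariant k
    invariant-add {k} k∈H (K , K⊆T , indUK)
      with contraction-augment K⊆T indUK (U-suc⊆span k (proj₂ (proj₂ k∈H))) (proj₂ (proj₂ (indepᵢ k k∈H)))
    ... | K′ , K′⊆T , indK′ = K′ , S∩B≥-antitone (n≤1+n k) ∘ K′⊆T , indep-↓ M (∪-mono U⊆ ⊆-refl) indK′
      where
      U⊆ : U k ⊆ I k ∪ U (suc k)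
      U⊆ = [ q⊆p∪q _ _ , (λ (_ , _ , x∈Ik) → p⊆p∪q _ x∈Ik) ] ∘ ∈U-split k

    invariant-skip : ¬ (k ≤ₙ h × parity k ≡ p) → Invariant (suc k) → Invariant k
    invariant-skip {k} k∉H (K , K⊆T , indUK) =
      K , S∩B≥-antitone (n≤1+n k) ∘ K⊆T , indep-↓ M (∪-mono U⊆ ⊆-refl) indUK
      where
      U⊆ : U k ⊆ U (suc k)
      U⊆ = [ id , (λ (k≤h , pk , _) → contradiction (k≤h , pk) k∉H) ] ∘ ∈U-split k

    invariant-step : 1 ≤ₙ k → Invariant (suc k) → Invariant k
    invariant-step {k} 1≤k with (k ≤? h) ×-dec (parity k ≟ₚ p)
    ... | yes (k≤h , pk) = invariant-add (1≤k , k≤h , pk)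
    ... | no  k∉H        = invariant-skip k∉H

    invariant : ∀ d → 1 ≤ₙ k → h <ₙ k + d → Invariant k
    invariant {k} zero    _   h<k+0 = invariant-above (subst (h <ₙ_) (+-identityʳ k) h<k+0)
    invariant {k} (suc d) 1≤k h<k+d =
      invariant-step 1≤k (invariant d (s≤s z≤n) (subst (h <ₙ_) (+-suc k d) h<k+d))

    ⋃H⊆U₁ : ⋃H p h I ⊆ U 1
    ⋃H⊆U₁ x∈ with ∈⋃H⁻ p h I x∈
    ... | i , (1≤i , i≤h , pi) , x∈Ii = ∈U⁺ 1≤i i≤h pi x∈Ii

    ⋃H-independent : Indep M (⋃H p h I)
    ⋃H-independent with invariant h ≤-refl ≤-refl
    ... | K , _ , indUK = indep-↓ M (p⊆p∪q K ∘ ⋃H⊆U₁) indUK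

lemma2 : ∀ {n} (M : Matroid n) (w : Fin n → ℚ) (W ρ̃ : ℚ) (h : ℕ) (β : Bucketing h)
    (S : Subset n) (p : Parity) (I : ℕ → Subset n) →
    (∀ e → 0ℚ < w e) → 0ℚ < W → 1ℚ ≤ ρ̃ → IsH ρ̃ h →
    (∀ i → InH p h i → Indepᵢ w W h β M S i (I i)) →
    Indep M (⋃H p h I)
lemma2 M w W ρ̃ h β S p I _ _ _ _ indepᵢ = Minors.Induction.⋃H-independent M w W h β S p I indepᵢ
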